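{- Let $c,m,n$ be positive integers with $m\le n$. Then the positive integer $L_{c,m,n}\,(n-m)!$ is a multiple (in $\mathbb{Z}$) of the positive integer \[\frac{\prod_{k=m}^{n}(k^2+c)}{h_c\left(\prod_{k=m}^{n}(k+\sqrt{ -c})\right)}.\]
   Context: For positive integers $c,m,n$ with $m\le n$, $L_{c,m,n}:=\mathrm{lcm}\{m^2+c,(m+1)^2+c,\dots,n^2+c\}$. Here $\sqrt{ -c}=i\sqrt{c}$, and $h_c:\mathbb{Z}[\sqrt{ -c}]\setminus\{0\}\to\mathbb{N}^*$ is the map $a+b\sqrt{ -c}\mapsto\gcd(a,b)$ for $a,b\in\mathbb{Z}$ not both zero. -}

module Defs where

open import Data.Nat using (ℕ; zero; suc; _+_; _*_; _∸_)
open import Data.Nat.GCD using (gcd)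
open import Data.Nat.LCM using (lcm)
open import Data.Integer as ℤ using (ℤ; +_; ∣_∣)
open import Data.List using (List; map; upTo; foldr)
open import Data.Nat.ListAction using (product)
open import Data.Product using (_×_; _,_)

range : ℕ → ℕ → List ℕ
range m n = map (λ i → m + i) (upTo (suc (n ∸ m)))

L : ℕ → ℕ → ℕ → ℕ
L c m n = foldr (λ k acc → lcm (k * k + c) acc) 1 (range m n)

normProd : ℕ → ℕ → ℕ → ℕ
normProd c m n = product (map (λ k → k * k + c) (range m n))

-- Elements of ℤ[√-c]: a + b √-c represented by the pair (a , b)
ZSqrt : Set
ZSqrt = ℤ × ℤ

mulZ : ℕ → ZSqrt → ZSqrt → ZSqrt
mulZ c (a , b) (a' , b') =
  ((a ℤ.* a') ℤ.- ((+ c) ℤ.* (b ℤ.* b')) , (a ℤ.* b') ℤ.+ (a' ℤ.* b))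

sqrtProd : ℕ → ℕ → ℕ → ZSqrt
sqrtProd c m n = foldr (λ k acc → mulZ c (+ k , + 1) acc) (+ 1 , + 0) (range m n)

h : ZSqrt → ℕ
h (a , b) = gcd ∣ a ∣ ∣ b ∣

{-# OPTIONS --safe #-}
-- In ℤ[√-c], P = ∏_{k=m}^{n} (k+√-c) divides M = L_{c,m,n}·(n−m)!. By induction on n−m: the
-- base case is m²+c = (m+√-c)(m−√-c), and if α₁ and α₂ witness this for [m … n−1] and
-- [m+1 … n], then α₁ − α₂ witnesses it for [m … n] because (n+√-c) − (m+√-c) = n−m.
-- Writing P = a+b√-c and αP = M, multiplying by the conjugate gives α·N(P) = M·(a−b√-c), so
-- N(P) divides M·gcd(a,b) = M·h(P); as h(P) also divides N(P) = a²+cb², the quotient N(P)/h(P)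
-- divides M. Finally N(P) = ∏(k²+c) by multiplicativity of the norm.
module Submission where

open import Defs
open import Data.Nat using (ℕ; _*_; _∸_; _≤_; NonZero; _!)
open import Data.Nat.Divisibility using (_∣_)
open import Data.Product using (∃-syntax; _×_)
open import Relation.Binary.PropositionalEquality using (_≡_)

open import Data.Nat as ℕ using (zero; suc; z≤n; s≤s; >-nonZero; >-nonZero⁻¹)
import Data.Nat.Properties as ℕ
open import Data.Nat.Divisibility using (divides; ∣-trans; m∣m*n; n∣m*n; ∣m∣n⇒∣m+n; *-cancelʳ-∣)
open import Data.Nat.GCD using (gcd[m,n]∣m; gcd[m,n]∣n; gcd-greatest; c*gcd[m,n]≡gcd[cm,cn])
open import Data.Nat.LCM using (lcm; m∣lcm[m,n]; n∣lcm[m,n])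
open import Data.Nat.ListAction using (product)
open import Data.Nat.ListAction.Properties using (product≢0)
open import Data.Integer as ℤ using (ℤ; +_; ∣_∣; -[1+_])
import Data.Integer.Properties as ℤ
open import Data.Integer.Tactic.RingSolver using (solve-∀)
open import Data.List using (List; []; _∷_; map; foldr; applyUpTo)
open import Data.List.Properties using (map-upTo)
open import Data.List.Relation.Unary.All using (universal)
open import Data.List.Relation.Unary.All.Properties using (map⁺)
open import Data.Product using (_,_; proj₁; proj₂)
open import Relation.Binary.PropositionalEquality using (refl; sym; trans; cong; cong₂; subst; module ≡-Reasoning)

∣-quotient : ∀ {d N M} .{{_ : NonZero N}} → d ∣ N → N ∣ M * d → ∃[ q ] (N ≡ q * d × q ∣ M)
∣-quotient {d} {N} {M} {{N≢0}} (divides q N≡q*d) N∣M*d =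
  q , N≡q*d , *-cancelʳ-∣ d {{ℕ.m*n≢0⇒n≢0 q {{subst NonZero N≡q*d N≢0}}}} (subst (_∣ M * d) N≡q*d N∣M*d)

consecutive : ℕ → ℕ → List ℕ
consecutive m zero = m ∷ []
consecutive m (suc t) = m ∷ consecutive (suc m) t

applyUpTo≡consecutive : ∀ {f} m t → (∀ i → f i ≡ m ℕ.+ i) → applyUpTo f (suc t) ≡ consecutive m t
applyUpTo≡consecutive m zero f≗m+ = cong (_∷ []) (trans (f≗m+ 0) (ℕ.+-identityʳ m))
applyUpTo≡consecutive m (suc t) f≗m+ =
  cong₂ _∷_ (trans (f≗m+ 0) (ℕ.+-identityʳ m))
            (applyUpTo≡consecutive (suc m) t (λ i → trans (f≗m+ (suc i)) (ℕ.+-suc m i)))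

-- Holds even when n < m (both sides are [m]), which is why corollary1 does not need m ≤ n.
range≡consecutive : ∀ m n → range m n ≡ consecutive m (n ∸ m)
range≡consecutive m n =
  trans (map-upTo (m ℕ.+_) (suc (n ∸ m))) (applyUpTo≡consecutive m (n ∸ m) (λ _ → refl))

module ℤ[√-_] (c : ℕ) where

  infixl 7 _·_
  infixl 6 _⊖_

  _·_ : ZSqrt → ZSqrt → ZSqrt
  _·_ = mulZ c

  _⊖_ : ZSqrt → ZSqrt → ZSqrt
  (a , b) ⊖ (a′ , b′) = (a ℤ.- a′ , b ℤ.- b′)

  ι : ℤ → ZSqrt
  ι a = (a , + 0)

  _+√-c : ℕ → ZSqrt
  k +√-c = (+ k , + 1)

  conj : ZSqrt → ZSqrt
  conj (a , b) = (a , ℤ.- b)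

  norm : ZSqrt → ℤ
  norm (a , b) = a ℤ.* a ℤ.+ + c ℤ.* (b ℤ.* b)

  ·-assoc : ∀ x y z → (x · y) · z ≡ x · (y · z)
  ·-assoc (a , b) (a′ , b′) (a″ , b″) = cong₂ _,_ (re (+ c) a b a′ b′ a″ b″) (im (+ c) a b a′ b′ a″ b″)
    where
    re : ∀ C a b a′ b′ a″ b″ →
      (a ℤ.* a′ ℤ.- C ℤ.* (b ℤ.* b′)) ℤ.* a″ ℤ.- C ℤ.* ((a ℤ.* b′ ℤ.+ a′ ℤ.* b) ℤ.* b″)
      ≡ a ℤ.* (a′ ℤ.* a″ ℤ.- C ℤ.* (b′ ℤ.* b″)) ℤ.- C ℤ.* (b ℤ.* (a′ ℤ.* b″ ℤ.+ a″ ℤ.* b′))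
    re = solve-∀
    im : ∀ C a b a′ b′ a″ b″ →
      (a ℤ.* a′ ℤ.- C ℤ.* (b ℤ.* b′)) ℤ.* b″ ℤ.+ a″ ℤ.* (a ℤ.* b′ ℤ.+ a′ ℤ.* b)
      ≡ a ℤ.* (a′ ℤ.* b″ ℤ.+ a″ ℤ.* b′) ℤ.+ (a′ ℤ.* a″ ℤ.- C ℤ.* (b′ ℤ.* b″)) ℤ.* b
    im = solve-∀

  ·-comm : ∀ x y → x · y ≡ y · x
  ·-comm (a , b) (a′ , b′) = cong₂ _,_ (re (+ c) a b a′ b′) (im a b a′ b′)
    where
    re : ∀ C a b a′ b′ → a ℤ.* a′ ℤ.- C ℤ.* (b ℤ.* b′) ≡ a′ ℤ.* a ℤ.- C ℤ.* (b′ ℤ.* b)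
    re = solve-∀
    im : ∀ a b a′ b′ → a ℤ.* b′ ℤ.+ a′ ℤ.* b ≡ a′ ℤ.* b ℤ.+ a ℤ.* b′
    im = solve-∀

  ·-identityʳ : ∀ x → x · ι (+ 1) ≡ x
  ·-identityʳ (a , b) = cong₂ _,_ (re (+ c) a b) (im a b)
    where
    re : ∀ C a b → a ℤ.* + 1 ℤ.- C ℤ.* (b ℤ.* + 0) ≡ a
    re = solve-∀
    im : ∀ a b → a ℤ.* + 0 ℤ.+ + 1 ℤ.* b ≡ b
    im = solve-∀

  ·-distribʳ-⊖ : ∀ x y z → (x ⊖ y) · z ≡ x · z ⊖ y · z
  ·-distribʳ-⊖ (a , b) (a′ , b′) (a″ , b″) = cong₂ _,_ (re (+ c) a b a′ b′ a″ b″) (im a b a′ b′ a″ b″)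
    where
    re : ∀ C a b a′ b′ a″ b″ →
      (a ℤ.- a′) ℤ.* a″ ℤ.- C ℤ.* ((b ℤ.- b′) ℤ.* b″)
      ≡ (a ℤ.* a″ ℤ.- C ℤ.* (b ℤ.* b″)) ℤ.- (a′ ℤ.* a″ ℤ.- C ℤ.* (b′ ℤ.* b″))
    re = solve-∀
    im : ∀ a b a′ b′ a″ b″ →
      (a ℤ.- a′) ℤ.* b″ ℤ.+ a″ ℤ.* (b ℤ.- b′)
      ≡ (a ℤ.* b″ ℤ.+ a″ ℤ.* b) ℤ.- (a′ ℤ.* b″ ℤ.+ a″ ℤ.* b′)
    im = solve-∀

  ·-distribˡ-⊖ : ∀ x y z → x · (y ⊖ z) ≡ x · y ⊖ x · z
  ·-distribˡ-⊖ x y z = begin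
    x · (y ⊖ z)     ≡⟨ ·-comm x (y ⊖ z) ⟩
    (y ⊖ z) · x     ≡⟨ ·-distribʳ-⊖ y z x ⟩
    y · x ⊖ z · x   ≡⟨ cong₂ _⊖_ (·-comm y x) (·-comm z x) ⟩
    x · y ⊖ x · z   ∎
    where open ≡-Reasoning

  ι-·ˡ : ∀ k a b → ι k · (a , b) ≡ (k ℤ.* a , k ℤ.* b)
  ι-·ˡ k a b = cong₂ _,_ (re (+ c) k a b) (im k a b)
    where
    re : ∀ C k a b → k ℤ.* a ℤ.- C ℤ.* (+ 0 ℤ.* b) ≡ k ℤ.* a
    re = solve-∀
    im : ∀ k a b → k ℤ.* b ℤ.+ a ℤ.* + 0 ≡ k ℤ.* b
    im = solve-∀

  ι-· : ∀ k l → ι k · ι l ≡ ι (k ℤ.* l)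
  ι-· k l = trans (ι-·ˡ k l (+ 0)) (cong (λ z → (k ℤ.* l , z)) (ℤ.*-zeroʳ k))

  ·-conj : ∀ x → x · conj x ≡ ι (norm x)
  ·-conj (a , b) = cong₂ _,_ (re (+ c) a b) (im a b)
    where
    re : ∀ C a b → a ℤ.* a ℤ.- C ℤ.* (b ℤ.* ℤ.- b) ≡ a ℤ.* a ℤ.+ C ℤ.* (b ℤ.* b)
    re = solve-∀
    im : ∀ a b → a ℤ.* ℤ.- b ℤ.+ a ℤ.* b ≡ + 0
    im = solve-∀

  norm-· : ∀ x y → norm (x · y) ≡ norm x ℤ.* norm y
  norm-· (a , b) (a′ , b′) = eq (+ c) a b a′ b′
    where
    eq : ∀ C a b a′ b′ →
      (a ℤ.* a′ ℤ.- C ℤ.* (b ℤ.* b′)) ℤ.* (a ℤ.* a′ ℤ.- C ℤ.* (b ℤ.* b′))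
        ℤ.+ C ℤ.* ((a ℤ.* b′ ℤ.+ a′ ℤ.* b) ℤ.* (a ℤ.* b′ ℤ.+ a′ ℤ.* b))
      ≡ (a ℤ.* a ℤ.+ C ℤ.* (b ℤ.* b)) ℤ.* (a′ ℤ.* a′ ℤ.+ C ℤ.* (b′ ℤ.* b′))
    eq = solve-∀

  _∣ᶻ_ : ZSqrt → ZSqrt → Set
  x ∣ᶻ y = ∃[ α ] (α · x ≡ y)

  sq+c : ℕ → ℕ
  sq+c k = k * k ℕ.+ c

  sq+c≢0 : .{{NonZero c}} → ∀ k → NonZero (sq+c k)
  sq+c≢0 k = >-nonZero (ℕ.<-≤-trans (>-nonZero⁻¹ c) (ℕ.m≤n+m c (k * k)))

  norm-+√-c : ∀ k → norm (k +√-c) ≡ + sq+c k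
  norm-+√-c k = begin
    + k ℤ.* + k ℤ.+ + c ℤ.* (+ 1 ℤ.* + 1)   ≡⟨ cong (λ z → + k ℤ.* + k ℤ.+ z) (ℤ.*-identityʳ (+ c)) ⟩
    + k ℤ.* + k ℤ.+ + c                      ≡⟨ cong (ℤ._+ + c) (ℤ.pos-* k k) ⟨
    + (k * k) ℤ.+ + c                        ≡⟨ ℤ.pos-+ (k * k) c ⟨
    + sq+c k                                 ∎
    where open ≡-Reasoning

  norm≡+∣∣ : ∀ a b → norm (a , b) ≡ + (∣ a ∣ * ∣ a ∣ ℕ.+ c * (∣ b ∣ * ∣ b ∣))
  norm≡+∣∣ a b = begin
    a ℤ.* a ℤ.+ + c ℤ.* (b ℤ.* b)                            ≡⟨ cong₂ (λ u v → u ℤ.+ + c ℤ.* v) (sq≡+∣∣² a) (sq≡+∣∣² b) ⟩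
    + (∣ a ∣ * ∣ a ∣) ℤ.+ + c ℤ.* + (∣ b ∣ * ∣ b ∣)           ≡⟨ cong (λ z → + (∣ a ∣ * ∣ a ∣) ℤ.+ z) (ℤ.pos-* c _) ⟨
    + (∣ a ∣ * ∣ a ∣) ℤ.+ + (c * (∣ b ∣ * ∣ b ∣))             ≡⟨ ℤ.pos-+ (∣ a ∣ * ∣ a ∣) _ ⟨
    + (∣ a ∣ * ∣ a ∣ ℕ.+ c * (∣ b ∣ * ∣ b ∣))                 ∎
    where
    open ≡-Reasoning
    sq≡+∣∣² : ∀ i → i ℤ.* i ≡ + (∣ i ∣ * ∣ i ∣)
    sq≡+∣∣² (+ n) = sym (ℤ.pos-* n n)
    sq≡+∣∣² -[1+ n ] = refl

  h∣∣norm∣ : ∀ x → h x ∣ ∣ norm x ∣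
  h∣∣norm∣ (a , b) rewrite norm≡+∣∣ a b =
    ∣m∣n⇒∣m+n (∣-trans (gcd[m,n]∣m ∣ a ∣ ∣ b ∣) (m∣m*n ∣ a ∣))
              (∣-trans (gcd[m,n]∣n ∣ a ∣ ∣ b ∣) (∣-trans (m∣m*n ∣ b ∣) (n∣m*n c)))

  ∣ᶻι⇒∣norm∣∣*h : ∀ x M → x ∣ᶻ ι (+ M) → ∣ norm x ∣ ∣ M * h x
  ∣ᶻι⇒∣norm∣∣*h x@(a , b) M ((u , v) , α·x≡M) =
    subst (∣ norm x ∣ ∣_) (sym (c*gcd[m,n]≡gcd[cm,cn] M ∣ a ∣ ∣ b ∣))
      (gcd-greatest (∣-scaled (cong proj₁ scaled))
                    (subst (λ k → ∣ norm x ∣ ∣ M * k) (ℤ.∣-i∣≡∣i∣ b) (∣-scaled (cong proj₂ scaled))))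
    where
    open ≡-Reasoning
    N = norm x
    scaled : (N ℤ.* u , N ℤ.* v) ≡ (+ M ℤ.* a , + M ℤ.* ℤ.- b)
    scaled = begin
      (N ℤ.* u , N ℤ.* v)        ≡⟨ ι-·ˡ N u v ⟨
      ι N · (u , v)              ≡⟨ ·-comm (ι N) (u , v) ⟩
      (u , v) · ι N              ≡⟨ cong ((u , v) ·_) (·-conj x) ⟨
      (u , v) · (x · conj x)     ≡⟨ ·-assoc (u , v) x (conj x) ⟨
      ((u , v) · x) · conj x     ≡⟨ cong (_· conj x) α·x≡M ⟩
      ι (+ M) · conj x           ≡⟨ ι-·ˡ (+ M) a (ℤ.- b) ⟩
      (+ M ℤ.* a , + M ℤ.* ℤ.- b) ∎
    ∣-scaled : ∀ {w e} → N ℤ.* w ≡ + M ℤ.* e → ∣ N ∣ ∣ M * ∣ e ∣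
    ∣-scaled {w} {e} eq = divides ∣ w ∣ (begin
      M * ∣ e ∣         ≡⟨ ℤ.abs-* (+ M) e ⟨
      ∣ + M ℤ.* e ∣     ≡⟨ cong ∣_∣ eq ⟨
      ∣ N ℤ.* w ∣       ≡⟨ ℤ.abs-* N w ⟩
      ∣ N ∣ * ∣ w ∣     ≡⟨ ℕ.*-comm ∣ N ∣ ∣ w ∣ ⟩
      ∣ w ∣ * ∣ N ∣     ∎)

  ∏+√-c : List ℕ → ZSqrt
  ∏+√-c = foldr (λ k acc → k +√-c · acc) (ι (+ 1))

  norm-∏ : ∀ xs → norm (∏+√-c xs) ≡ + product (map sq+c xs)
  norm-∏ [] = norm-one (+ c)
    where
    norm-one : ∀ C → + 1 ℤ.* + 1 ℤ.+ C ℤ.* (+ 0 ℤ.* + 0) ≡ + 1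
    norm-one = solve-∀
  norm-∏ (k ∷ xs) = begin
    norm (k +√-c · ∏+√-c xs)                  ≡⟨ norm-· (k +√-c) (∏+√-c xs) ⟩
    norm (k +√-c) ℤ.* norm (∏+√-c xs)         ≡⟨ cong₂ ℤ._*_ (norm-+√-c k) (norm-∏ xs) ⟩
    + sq+c k ℤ.* + product (map sq+c xs)      ≡⟨ ℤ.pos-* (sq+c k) _ ⟨
    + product (map sq+c (k ∷ xs))             ∎
    where open ≡-Reasoning

  ∏-consecutive-suc : ∀ m t → ∏+√-c (consecutive m (suc t)) ≡ ∏+√-c (consecutive m t) · (m ℕ.+ suc t) +√-c
  ∏-consecutive-suc m zero = begin
    m +√-c · (suc m +√-c · ι (+ 1))     ≡⟨ cong (m +√-c ·_) (·-identityʳ (suc m +√-c)) ⟩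
    m +√-c · suc m +√-c                 ≡⟨ cong (λ k → m +√-c · k +√-c) (ℕ.+-comm 1 m) ⟩
    m +√-c · (m ℕ.+ 1) +√-c             ≡⟨ cong (_· (m ℕ.+ 1) +√-c) (·-identityʳ (m +√-c)) ⟨
    (m +√-c · ι (+ 1)) · (m ℕ.+ 1) +√-c ∎
    where open ≡-Reasoning
  ∏-consecutive-suc m (suc t) = begin
    m +√-c · ∏+√-c (consecutive (suc m) (suc t))                  ≡⟨ cong (m +√-c ·_) (∏-consecutive-suc (suc m) t) ⟩
    m +√-c · (∏+√-c (consecutive (suc m) t) · X)                  ≡⟨ ·-assoc (m +√-c) _ X ⟨
    ∏+√-c (consecutive m (suc t)) · X                              ≡⟨ cong (λ k → ∏+√-c (consecutive m (suc t)) · k +√-c) (ℕ.+-suc m (suc t)) ⟨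
    ∏+√-c (consecutive m (suc t)) · (m ℕ.+ suc (suc t)) +√-c      ∎
    where
    open ≡-Reasoning
    X = (suc m ℕ.+ suc t) +√-c

  lcm-sq+c : List ℕ → ℕ
  lcm-sq+c = foldr (λ k acc → lcm (sq+c k) acc) 1

  sq+c∣lcm-sq+c-consecutive : ∀ m t i → i ≤ t → sq+c (m ℕ.+ i) ∣ lcm-sq+c (consecutive m t)
  sq+c∣lcm-sq+c-consecutive m t zero _ =
    subst (λ k → sq+c k ∣ lcm-sq+c (consecutive m t)) (sym (ℕ.+-identityʳ m)) (head∣ t)
    where
    head∣ : ∀ t → sq+c m ∣ lcm-sq+c (consecutive m t)
    head∣ zero = m∣lcm[m,n] _ _
    head∣ (suc t) = m∣lcm[m,n] _ _
  sq+c∣lcm-sq+c-consecutive m (suc t) (suc i) (s≤s i≤t) =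
    subst (λ k → sq+c k ∣ lcm-sq+c (consecutive m (suc t))) (sym (ℕ.+-suc m i))
      (∣-trans (sq+c∣lcm-sq+c-consecutive (suc m) t i i≤t) (n∣lcm[m,n] (sq+c m) _))

  +√-c-⊖ : ∀ m s → (m ℕ.+ s) +√-c ⊖ m +√-c ≡ ι (+ s)
  +√-c-⊖ m s = cong (_, + 0) (trans (cong (ℤ._- + m) (ℤ.pos-+ m s)) (cancel (+ m) (+ s)))
    where
    cancel : ∀ m s → m ℤ.+ s ℤ.- m ≡ s
    cancel = solve-∀

  ∏-consecutive∣ᶻι[D*t!] : ∀ m t D → (∀ i → i ≤ t → sq+c (m ℕ.+ i) ∣ D) →
    ∏+√-c (consecutive m t) ∣ᶻ ι (+ (D * t !))
  ∏-consecutive∣ᶻι[D*t!] m zero D sq+c∣D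
    with subst (λ k → sq+c k ∣ D) (ℕ.+-identityʳ m) (sq+c∣D 0 z≤n)
  ... | divides q D≡q*sq+c = ι (+ q) · conj (m +√-c) , (begin
    ι (+ q) · conj (m +√-c) · (m +√-c · ι (+ 1))  ≡⟨ cong (ι (+ q) · conj (m +√-c) ·_) (·-identityʳ (m +√-c)) ⟩
    ι (+ q) · conj (m +√-c) · m +√-c              ≡⟨ ·-assoc (ι (+ q)) _ _ ⟩
    ι (+ q) · (conj (m +√-c) · m +√-c)            ≡⟨ cong (ι (+ q) ·_) (·-comm _ (m +√-c)) ⟩
    ι (+ q) · (m +√-c · conj (m +√-c))            ≡⟨ cong (ι (+ q) ·_) (·-conj (m +√-c)) ⟩
    ι (+ q) · ι (norm (m +√-c))                   ≡⟨ cong (λ z → ι (+ q) · ι z) (norm-+√-c m) ⟩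
    ι (+ q) · ι (+ sq+c m)                        ≡⟨ ι-· (+ q) _ ⟩
    ι (+ q ℤ.* + sq+c m)                          ≡⟨ cong ι (ℤ.pos-* q _) ⟨
    ι (+ (q * sq+c m))                            ≡⟨ cong (λ k → ι (+ k)) (trans (sym D≡q*sq+c) (sym (ℕ.*-identityʳ D))) ⟩
    ι (+ (D * 1))                                 ∎)
    where open ≡-Reasoning
  ∏-consecutive∣ᶻι[D*t!] m (suc t) D sq+c∣D
    with ∏-consecutive∣ᶻι[D*t!] m t D (λ i i≤t → sq+c∣D i (ℕ.m≤n⇒m≤1+n i≤t))
       | ∏-consecutive∣ᶻι[D*t!] (suc m) t D
           (λ i i≤t → subst (λ k → sq+c k ∣ D) (ℕ.+-suc m i) (sq+c∣D (suc i) (s≤s i≤t)))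
  ... | α₁ , α₁·P≡K | α₂ , α₂·Q≡K = α₁ ⊖ α₂ , (begin
    (α₁ ⊖ α₂) · P′               ≡⟨ ·-distribʳ-⊖ α₁ α₂ P′ ⟩
    α₁ · P′ ⊖ α₂ · P′            ≡⟨ cong₂ _⊖_ α₁·P′≡K·X α₂·P′≡K·m ⟩
    K · X ⊖ K · m +√-c           ≡⟨ ·-distribˡ-⊖ K X (m +√-c) ⟨
    K · (X ⊖ m +√-c)             ≡⟨ cong (K ·_) (+√-c-⊖ m (suc t)) ⟩
    K · ι (+ suc t)              ≡⟨ ι-· (+ (D * t !)) (+ suc t) ⟩
    ι (+ (D * t !) ℤ.* + suc t)  ≡⟨ cong ι (ℤ.pos-* (D * t !) (suc t)) ⟨
    ι (+ (D * t ! * suc t))      ≡⟨ cong (λ k → ι (+ k)) (trans (ℕ.*-assoc D (t !) (suc t)) (cong (D *_) (ℕ.*-comm (t !) (suc t)))) ⟩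
    ι (+ (D * suc t !))          ∎)
    where
    open ≡-Reasoning
    P = ∏+√-c (consecutive m t)
    Q = ∏+√-c (consecutive (suc m) t)
    P′ = ∏+√-c (consecutive m (suc t))
    K = ι (+ (D * t !))
    X = (m ℕ.+ suc t) +√-c
    α₁·P′≡K·X : α₁ · P′ ≡ K · X
    α₁·P′≡K·X = begin
      α₁ · P′         ≡⟨ cong (α₁ ·_) (∏-consecutive-suc m t) ⟩
      α₁ · (P · X)    ≡⟨ ·-assoc α₁ P X ⟨
      α₁ · P · X      ≡⟨ cong (_· X) α₁·P≡K ⟩
      K · X           ∎
    α₂·P′≡K·m : α₂ · P′ ≡ K · m +√-c
    α₂·P′≡K·m = begin
      α₂ · (m +√-c · Q)   ≡⟨ cong (α₂ ·_) (·-comm (m +√-c) Q) ⟩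
      α₂ · (Q · m +√-c)   ≡⟨ ·-assoc α₂ Q (m +√-c) ⟨
      α₂ · Q · m +√-c     ≡⟨ cong (_· m +√-c) α₂·Q≡K ⟩
      K · m +√-c          ∎

corollary1 : (c m n : ℕ) → .{{_ : NonZero c}} → .{{_ : NonZero m}} → m ≤ n →
    ∃[ q ] (normProd c m n ≡ q * h (sqrtProd c m n) × q ∣ L c m n * ((n ∸ m) !))
corollary1 c m n _ =
  subst (λ N → ∃[ q ] (N ≡ q * h P × q ∣ M)) ∣normP∣≡normProd
    (∣-quotient {{subst NonZero (sym ∣normP∣≡normProd) normProd≢0}} (h∣∣norm∣ P) (∣ᶻι⇒∣norm∣∣*h P M P∣M))
  where
  open ℤ[√-_] c
  P = sqrtProd c m n
  M = L c m n * (n ∸ m) !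
  ∣normP∣≡normProd : ∣ norm P ∣ ≡ normProd c m n
  ∣normP∣≡normProd = cong ∣_∣ (norm-∏ (range m n))
  normProd≢0 : NonZero (normProd c m n)
  normProd≢0 = product≢0 (map⁺ (universal sq+c≢0 (range m n)))
  P∣M : P ∣ᶻ ι (+ M)
  P∣M = subst (λ xs → ∏+√-c xs ∣ᶻ ι (+ M)) (sym (range≡consecutive m n))
    (∏-consecutive∣ᶻι[D*t!] m (n ∸ m) (L c m n) λ i i≤t →
      subst (λ xs → sq+c (m ℕ.+ i) ∣ lcm-sq+c xs) (sym (range≡consecutive m n))
        (sq+c∣lcm-sq+c-consecutive m (n ∸ m) i i≤t))
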